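{- Let $(x,y)$ be a feasible solution of $\mathrm{LP}(\lambda)$ and let $(x',y')$ be obtained from it by the rerouting described in the context. Then: (1) $(x',y')$ is a feasible solution of $\mathrm{LP}((\alpha+1)\lambda)$; (2) $\sum_{j\in P}x'_{ij}\ge1$ for all $i\in\mathcal{C}_{\mathrm{DS}}$; (3) $y'$ is integral.
   Context: Let $(P,d)$ be a finite metric space, $k\in\{1,\dots,|P|\}$, $P=P_1\,\dot\cup\dots\dot\cup\,P_m$ a partition into color classes, $H=\{1,\dots,m\}$, with bounds $0\le\ell_h\le u_h\le1$. For $\mu\ge0$, $\mathrm{LP}(\mu)$ is the system in variables $x_{ij},y_i$ ($i,j\in P$; $x_{ij}$ is the mass $j$ sends to $i$): $\sum_{i\in P}x_{ij}=1$ for all $j$; $x_{ij}\le y_i$; $\sum_iy_i\le k$; $\ell_h\sum_{j\in P}x_{ij}\le\sum_{j\in P_h}x_{ij}\le u_h\sum_{j\in P}x_{ij}$ for all $h\in H,i\in P$; $x_{ij}=0$ whenever $d(i,j)>\mu$; $0\le x_{ij},y_i\le1$. Let $\mathcal{C}_{\mathrm{DS}}\subseteq P$ with $|\mathcal{C}_{\mathrm{DS}}|\le k$ be the center set returned by an $\alpha$-approximation algorithm for $k$-center with diverse center selection, and let $\lambda\ge0$ be such that every $p\in P$ satisfies $\min_{i\in\mathcal{C}_{\mathrm{DS}}}d(p,i)\le\alpha\lambda$ (this holds for $\lambda=\max\{\lambda^{\mathrm{LP}},\lambda^{\mathrm{DS}}\}$, where $\lambda^{\mathrm{LP}}$ is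 the least value with $\mathrm{LP}(\lambda^{\mathrm{LP}})$ feasible and $\lambda^{\mathrm{DS}}$ the least value with the returned solution's cost at most $\alpha\lambda^{\mathrm{DS}}$). For $j\in P$ let $N(j)=\{i\in P\mid x_{ij}>0\}$, and $N(P')=\bigcup_{j\in P'}N(j)$. Let $\theta:P\setminus N(\mathcal{C}_{\mathrm{DS}})\to\mathcal{C}_{\mathrm{DS}}$ with $\theta(p)=p$ if $p\in\mathcal{C}_{\mathrm{DS}}$ and otherwise $\theta(p)\in\arg\min_{i'\in\mathcal{C}_{\mathrm{DS}}}d(p,i')$. The rerouting is: $y'_i=1$ if $i\in\mathcal{C}_{\mathrm{DS}}$, $y'_i=0$ otherwise; and for $i\in\mathcal{C}_{\mathrm{DS}}$, $x'_{ij}=\sum_{p\in N(i)}\frac{x_{pi}}{\sum_{c\in\mathcal{C}_{\mathrm{DS}}:\,p\in N(c)}x_{pc}}x_{pj}+\sum_{p\in\theta^{ -1}(i)}x_{pj}$, while $x'_{ij}=0$ for $i\notin\mathcal{C}_{\mathrm{DS}}$.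
   Formalization: The distances $d$, the entries of the LP solution $(x,y)$, the bounds $\ell_h$, $u_h$ and the parameters $\alpha$ and $\lambda$ are all rational. -}

module Defs where

open import Data.Nat as ℕ using (ℕ; zero; suc)
open import Data.Fin using (Fin)
open import Data.Fin.Subset using (Subset; _∈_; _∉_; ∣_∣)
open import Data.Fin.Subset.Properties using (_∈?_)
open import Data.Fin.Properties using (any?)
open import Data.Integer using (+_)
open import Data.Rational using (ℚ; 0ℚ; 1ℚ; _+_; _*_; _≤_; _<_; _/_; 1/_; ≢-nonZero)
open import Data.Rational.Properties using (_≟_; _<?_)
open import Data.Product using (_×_; ∃; _,_)
open import Relation.Nullary using (Dec; yes; no; ¬_; _×-dec_)
open import Relation.Binary.PropositionalEquality using (_≡_)

Σ[_] : ∀ {n} → (Fin n → ℚ) → ℚ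
Σ[_] {zero}  f = 0ℚ
Σ[_] {suc n} f = f Fin.zero + Σ[_] {n} (λ j → f (Fin.suc j))
  where import Data.Fin as Fin

ΣIf : ∀ {n} {P : Fin n → Set} → ((j : Fin n) → Dec (P j)) → (Fin n → ℚ) → ℚ
ΣIf P? f = Σ[ (λ j → ite (P? j) (f j)) ]
  where
  ite : ∀ {A : Set} → Dec A → ℚ → ℚ
  ite (yes _) q = q
  ite (no _)  _ = 0ℚ

ℕtoℚ : ℕ → ℚ
ℕtoℚ k = (+ k) / 1

-- Reciprocal, made total by 1/0 := 0 (only ever applied to positive values).
inv : ℚ → ℚ
inv q with q ≟ 0ℚ
... | yes _  = 0ℚ
... | no q≢0 = 1/_ q {{≢-nonZero q≢0}}

IsMetric : ∀ {n} → (Fin n → Fin n → ℚ) → Set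
IsMetric {n} d =
    (∀ i j → 0ℚ ≤ d i j)
  × (∀ i j → d i j ≡ 0ℚ → i ≡ j)
  × (∀ i → d i i ≡ 0ℚ)
  × (∀ i j → d i j ≡ d j i)
  × (∀ i j l → d i l ≤ d i j + d j l)

ΣColour : ∀ {n m} → (Fin n → Fin m) → Fin m → (Fin n → ℚ) → ℚ
ΣColour col h f = ΣIf (λ j → col j Data.Fin.≟ h) f
  where import Data.Fin

-- Feasibility of LP(μ). x i j = mass that j sends to i.
LPFeasible : ∀ {n m} (d : Fin n → Fin n → ℚ) (k : ℕ) (col : Fin n → Fin m)
             (ℓ u : Fin m → ℚ) (μ : ℚ)
             (x : Fin n → Fin n → ℚ) (y : Fin n → ℚ) → Set
LPFeasible d k col ℓ u μ x y =
    (∀ j → Σ[ (λ i → x i j) ] ≡ 1ℚ)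
  × (∀ i j → x i j ≤ y i)
  × (Σ[ y ] ≤ ℕtoℚ k)
  × (∀ h i → ℓ h * Σ[ x i ] ≤ ΣColour col h (x i))
  × (∀ h i → ΣColour col h (x i) ≤ u h * Σ[ x i ])
  × (∀ i j → μ < d i j → x i j ≡ 0ℚ)
  × (∀ i j → 0ℚ ≤ x i j × x i j ≤ 1ℚ)
  × (∀ i → 0ℚ ≤ y i × y i ≤ 1ℚ)

InN : ∀ {n} → (Fin n → Fin n → ℚ) → Subset n → Fin n → Set
InN x C p = ∃ λ c → c ∈ C × 0ℚ < x p c

inN? : ∀ {n} (x : Fin n → Fin n → ℚ) (C : Subset n) (p : Fin n) → Dec (InN x C p)
inN? x C p = any? (λ c → (c ∈? C) ×-dec (0ℚ <? x p c))

-- Requirements on θ : P ∖ N(C) → C (values outside that domain are irrelevant).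
IsTheta : ∀ {n} (d : Fin n → Fin n → ℚ) (x : Fin n → Fin n → ℚ) (C : Subset n)
          (θ : Fin n → Fin n) → Set
IsTheta d x C θ = ∀ p → ¬ InN x C p →
    (θ p ∈ C)
  × (p ∈ C → θ p ≡ p)
  × (p ∉ C → ∀ i' → i' ∈ C → d p (θ p) ≤ d p i')

rerouteY : ∀ {n} → Subset n → Fin n → ℚ
rerouteY C i with i ∈? C
... | yes _ = 1ℚ
... | no _  = 0ℚ

denom : ∀ {n} → (Fin n → Fin n → ℚ) → Subset n → Fin n → ℚ
denom x C p = ΣIf (λ c → (c ∈? C) ×-dec (0ℚ <? x p c)) (x p)

rerouteX : ∀ {n} → (Fin n → Fin n → ℚ) → Subset n → (Fin n → Fin n) →
           Fin n → Fin n → ℚ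
rerouteX x C θ i j with i ∈? C
... | no _  = 0ℚ
... | yes _ =
      ΣIf (λ p → 0ℚ <? x p i) (λ p → (x p i * inv (denom x C p)) * x p j)
    + ΣIf (λ p → dnot (inN? x C p) ×-dec (θ p Data.Fin.≟ i)) (λ p → x p j)
  where
  import Data.Fin
  dnot : ∀ {A : Set} → Dec A → Dec (¬ A)
  dnot (yes a) = no (λ f → f a)
  dnot (no na) = yes na

{-# OPTIONS --safe #-}
module Submission where

-- The rerouted assignment is x' = W · x, where column p of W spreads the mass received by p over
-- the centres: to a centre i in proportion x_{pi} / D(p), D(p) = Σ_{c ∈ C} x_{pc}, if p serves some
-- centre, and entirely to θ(p) otherwise.  W is nonnegative and its columns sum to 1, so x' has the
-- column sums of x, and every row of x' is a nonnegative combination of rows of x, hence satisfies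
-- every homogeneous linear row constraint of x, in particular the fairness bounds.  If x'_{ij} > 0
-- then some p has d(p,j) ≤ λ and W_{ip} > 0, whence d(p,i) ≤ αλ and d(i,j) ≤ (α+1)λ.  For a
-- centre i, W_{ip} Σ_j x_{pj} ≥ (x_{pi} / D(p)) D(p) = x_{pi}, so row i of x' has mass at least
-- Σ_p x_{pi} = 1.

open import Defs
open import Data.Nat using (ℕ; _≤_)
open import Data.Fin using (Fin)
open import Data.Fin.Subset using (Subset; _∈_; ∣_∣)
open import Data.Rational using (ℚ; 0ℚ; 1ℚ; _+_; _*_) renaming (_≤_ to _≤ℚ_)
open import Data.Product using (_×_; ∃)
open import Data.Sum using (_⊎_)
open import Function using (Surjective)
open import Relation.Binary.PropositionalEquality using (_≡_)

open import Algebra.Bundles using (CommutativeMonoid; CommutativeRing)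
open import Data.Bool using (if_then_else_)
open import Data.Fin as Fin using (zero; suc) renaming (_≟_ to _≟ᶠ_)
open import Data.Fin.Subset using (_∉_; inside; outside)
import Data.Vec as Vec
open import Data.Fin.Subset.Properties using (_∈?_)
import Data.Fin.Properties as Fin
import Data.Integer as ℤ
import Data.Integer.Properties as ℤ
import Data.Nat.Properties as ℕ
open import Data.Nat.Coprimality using (1-coprimeTo) renaming (sym to coprime-sym)
open import Data.Product using (_,_; proj₁; proj₂)
open import Data.Rational using (_<_; mkℚ; *≤*; Positive; ≢-nonZero; nonNegative)
open import Data.Rational.Properties
  using ( _≟_; _<?_; ≤-refl; ≤-reflexive; ≤-trans; ≤-antisym; <-irrefl; <⇒≤; ≮⇒≥; ≰⇒>; <-≤-trans; ≤-<-trans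
        ; +-mono-≤; *-monoˡ-≤-nonNeg; *-monoʳ-≤-nonNeg; nonNegative⁻¹; positive⁻¹
        ; nonNeg∧nonZero⇒pos; 1/pos⇒pos; nonNeg*nonNeg⇒nonNeg
        ; *-assoc; *-identityˡ; *-identityʳ; *-zeroˡ; *-zeroʳ; *-distribʳ-+
        ; +-identityˡ; +-identityʳ; *-inverseˡ; *-inverseʳ; normalize-coprime
        ; +-*-commutativeRing; *-1-commutativeMonoid; module ≤-Reasoning )
open import Data.Sum using (inj₁; inj₂)
open import Function using (_∘_)
open import Relation.Binary.PropositionalEquality
  using (refl; sym; trans; cong; cong₂; subst; subst₂; _≢_; _≗_; module ≡-Reasoning)
open import Relation.Nullary using (Dec; yes; no; does; ¬_; _×-dec_; contradiction)
open import Relation.Nullary.Decidable using (¬?; toSum; dec-true; dec-false; dec-yes)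

open import Algebra.Properties.Semiring.Sum (CommutativeRing.semiring +-*-commutativeRing)
  using (sum; sum-cong-≗; sum-replicate-zero; ∑-distrib-+; ∑-comm; *-distribˡ-sum; *-distribʳ-sum)
open import Algebra.Properties.CommutativeSemigroup
  (CommutativeMonoid.commutativeSemigroup *-1-commutativeMonoid) using (x∙yz≈y∙xz)

0≤1 : 0ℚ ≤ℚ 1ℚ
0≤1 = nonNegative⁻¹ 1ℚ

<⇒≱ : ∀ {p q} → p < q → ¬ q ≤ℚ p
<⇒≱ p<q q≤p = <-irrefl refl (<-≤-trans p<q q≤p)

+-nonNeg : ∀ {p q} → 0ℚ ≤ℚ p → 0ℚ ≤ℚ q → 0ℚ ≤ℚ p + q
+-nonNeg = +-mono-≤

p≤p+q : ∀ {p q} → 0ℚ ≤ℚ q → p ≤ℚ p + q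
p≤p+q {p} {q} 0≤q = subst (_≤ℚ p + q) (+-identityʳ p) (+-mono-≤ (≤-refl {p}) 0≤q)

*-nonNeg : ∀ {p q} → 0ℚ ≤ℚ p → 0ℚ ≤ℚ q → 0ℚ ≤ℚ p * q
*-nonNeg {p} {q} 0≤p 0≤q =
  nonNegative⁻¹ _ {{nonNeg*nonNeg⇒nonNeg p {{nonNegative 0≤p}} q {{nonNegative 0≤q}}}}

q*inv[q]≡1 : ∀ q → q ≢ 0ℚ → q * inv q ≡ 1ℚ
q*inv[q]≡1 q q≢0 with q ≟ 0ℚ
... | yes q≡0 = contradiction q≡0 q≢0
... | no  q≢0 = *-inverseʳ q {{≢-nonZero q≢0}}

inv-nonNeg : ∀ {q} → 0ℚ ≤ℚ q → 0ℚ ≤ℚ inv q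
inv-nonNeg {q} 0≤q with q ≟ 0ℚ
... | yes _   = ≤-refl
... | no  q≢0 = <⇒≤ (positive⁻¹ _ {{1/pos⇒pos q {{q>0}}}})
  where
  q>0 : Positive q
  q>0 = nonNeg∧nonZero⇒pos q {{nonNegative 0≤q}} {{≢-nonZero q≢0}}

-- With 1/0 = 0 this still holds at q = 0, because then a = 0.
a*inv[q]*q≡a : ∀ {a q} → 0ℚ ≤ℚ a → a ≤ℚ q → a * inv q * q ≡ a
a*inv[q]*q≡a {a} {q} 0≤a a≤q with q ≟ 0ℚ
... | yes refl rewrite ≤-antisym a≤q 0≤a = *-zeroʳ (0ℚ * inv 0ℚ)
... | no  q≢0 = trans (*-assoc a _ q) (trans (cong (a *_) (*-inverseˡ q {{≢-nonZero q≢0}})) (*-identityʳ a))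

ℕtoℚ≡mkℚ : ∀ n → ℕtoℚ n ≡ mkℚ (ℤ.+ n) 0 (coprime-sym (1-coprimeTo n))
ℕtoℚ≡mkℚ n = normalize-coprime _

ℕtoℚ-suc : ∀ n → ℕtoℚ (ℕ.suc n) ≡ 1ℚ + ℕtoℚ n
ℕtoℚ-suc n rewrite ℕtoℚ≡mkℚ n | ℕ.*-identityʳ n | ℤ.+◃n≡+n n = refl

ℕtoℚ-mono-≤ : ∀ {a b} → a ≤ b → ℕtoℚ a ≤ℚ ℕtoℚ b
ℕtoℚ-mono-≤ {a} {b} a≤b rewrite ℕtoℚ≡mkℚ a | ℕtoℚ≡mkℚ b =
  *≤* (ℤ.*-monoʳ-≤-nonNeg (ℤ.+ 1) (ℤ.+≤+ a≤b))

-- Only `does` is inspected, so that 𝟙 (suc i ∈? s ∷ C) reduces to 𝟙 (i ∈? C).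
𝟙 : ∀ {A : Set} → Dec A → ℚ
𝟙 a = if does a then 1ℚ else 0ℚ

module _ {A : Set} where

  𝟙-yes : (a : Dec A) → A → 𝟙 a ≡ 1ℚ
  𝟙-yes a x rewrite dec-true a x = refl

  𝟙-no : (a : Dec A) → ¬ A → 𝟙 a ≡ 0ℚ
  𝟙-no a ¬x rewrite dec-false a ¬x = refl

  𝟙-nonNeg : (a : Dec A) → 0ℚ ≤ℚ 𝟙 a
  𝟙-nonNeg (yes _) = 0≤1
  𝟙-nonNeg (no _)  = ≤-refl

  𝟙+𝟙¬≡1 : (a : Dec A) → 𝟙 a + 𝟙 (¬? a) ≡ 1ℚ
  𝟙+𝟙¬≡1 (yes _) = refl
  𝟙+𝟙¬≡1 (no _)  = refl

  𝟙*-yes : (a : Dec A) {q : ℚ} → A → 𝟙 a * q ≡ q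
  𝟙*-yes a {q} x = trans (cong (_* q) (𝟙-yes a x)) (*-identityˡ q)

  𝟙*≡0 : (a : Dec A) {q : ℚ} → (A → q ≡ 0ℚ) → 𝟙 a * q ≡ 0ℚ
  𝟙*≡0 (yes x) {q} q≡0 = trans (*-identityˡ q) (q≡0 x)
  𝟙*≡0 (no _)  {q} _   = *-zeroˡ q

  𝟙*-≤ : (a : Dec A) {q : ℚ} → 0ℚ ≤ℚ q → 𝟙 a * q ≤ℚ q
  𝟙*-≤ (yes _) {q} _   = ≤-reflexive (*-identityˡ q)
  𝟙*-≤ (no _)  {q} 0≤q = subst (_≤ℚ q) (sym (*-zeroˡ q)) 0≤q

Σ≡sum : ∀ {n} (f : Fin n → ℚ) → Σ[ f ] ≡ sum f
Σ≡sum {ℕ.zero}  f = refl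
Σ≡sum {ℕ.suc n} f = cong (f zero +_) (Σ≡sum (f ∘ suc))

Σ-cong : ∀ {n} {f g : Fin n → ℚ} → f ≗ g → Σ[ f ] ≡ Σ[ g ]
Σ-cong {f = f} {g} f≗g = trans (Σ≡sum f) (trans (sum-cong-≗ f≗g) (sym (Σ≡sum g)))

Σ-zero : ∀ {n} {f : Fin n → ℚ} → (∀ i → f i ≡ 0ℚ) → Σ[ f ] ≡ 0ℚ
Σ-zero {n} {f} f≡0 = trans (Σ≡sum f) (trans (sum-cong-≗ f≡0) (sum-replicate-zero n))

Σ-distrib-+ : ∀ {n} (f g : Fin n → ℚ) → Σ[ (λ i → f i + g i) ] ≡ Σ[ f ] + Σ[ g ]
Σ-distrib-+ f g = begin
  Σ[ (λ i → f i + g i) ]  ≡⟨ Σ≡sum (λ i → f i + g i) ⟩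
  sum (λ i → f i + g i)   ≡⟨ ∑-distrib-+ f g ⟩
  sum f + sum g           ≡⟨ cong₂ _+_ (Σ≡sum f) (Σ≡sum g) ⟨
  Σ[ f ] + Σ[ g ]         ∎
  where open ≡-Reasoning

*-distribˡ-Σ : ∀ {n} c (f : Fin n → ℚ) → c * Σ[ f ] ≡ Σ[ (λ i → c * f i) ]
*-distribˡ-Σ c f = begin
  c * Σ[ f ]              ≡⟨ cong (c *_) (Σ≡sum f) ⟩
  c * sum f               ≡⟨ *-distribˡ-sum c f ⟩
  sum (λ i → c * f i)     ≡⟨ Σ≡sum (λ i → c * f i) ⟨
  Σ[ (λ i → c * f i) ]    ∎
  where open ≡-Reasoning

*-distribʳ-Σ : ∀ {n} c (f : Fin n → ℚ) → Σ[ f ] * c ≡ Σ[ (λ i → f i * c) ]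
*-distribʳ-Σ c f = begin
  Σ[ f ] * c              ≡⟨ cong (_* c) (Σ≡sum f) ⟩
  sum f * c               ≡⟨ *-distribʳ-sum c f ⟩
  sum (λ i → f i * c)     ≡⟨ Σ≡sum (λ i → f i * c) ⟨
  Σ[ (λ i → f i * c) ]    ∎
  where open ≡-Reasoning

Σ-comm : ∀ {m n} (f : Fin m → Fin n → ℚ) →
         Σ[ (λ i → Σ[ (λ j → f i j) ]) ] ≡ Σ[ (λ j → Σ[ (λ i → f i j) ]) ]
Σ-comm f = begin
  Σ[ (λ i → Σ[ (λ j → f i j) ]) ]    ≡⟨ Σ-cong (λ i → Σ≡sum (f i)) ⟩
  Σ[ (λ i → sum (λ j → f i j)) ]     ≡⟨ Σ≡sum (λ i → sum (f i)) ⟩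
  sum (λ i → sum (λ j → f i j))      ≡⟨ ∑-comm f ⟩
  sum (λ j → sum (λ i → f i j))      ≡⟨ Σ≡sum (λ j → sum (λ i → f i j)) ⟨
  Σ[ (λ j → sum (λ i → f i j)) ]     ≡⟨ Σ-cong (λ j → Σ≡sum (λ i → f i j)) ⟨
  Σ[ (λ j → Σ[ (λ i → f i j) ]) ]    ∎
  where open ≡-Reasoning

Σ-mono-≤ : ∀ {n} {f g : Fin n → ℚ} → (∀ i → f i ≤ℚ g i) → Σ[ f ] ≤ℚ Σ[ g ]
Σ-mono-≤ {ℕ.zero}  _   = ≤-refl
Σ-mono-≤ {ℕ.suc n} f≤g = +-mono-≤ (f≤g zero) (Σ-mono-≤ (f≤g ∘ suc))

Σ-nonNeg : ∀ {n} {f : Fin n → ℚ} → (∀ i → 0ℚ ≤ℚ f i) → 0ℚ ≤ℚ Σ[ f ]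
Σ-nonNeg {ℕ.zero}  _     = ≤-refl
Σ-nonNeg {ℕ.suc n} 0≤f = +-nonNeg (0≤f zero) (Σ-nonNeg (0≤f ∘ suc))

term≤Σ : ∀ {n} {f : Fin n → ℚ} → (∀ i → 0ℚ ≤ℚ f i) → ∀ i → f i ≤ℚ Σ[ f ]
term≤Σ {f = f} 0≤f zero =
  subst (_≤ℚ Σ[ f ]) (+-identityʳ (f zero)) (+-mono-≤ (≤-refl {f zero}) (Σ-nonNeg (0≤f ∘ suc)))
term≤Σ {f = f} 0≤f (suc i) =
  subst (_≤ℚ Σ[ f ]) (+-identityˡ (f (suc i))) (+-mono-≤ (0≤f zero) (term≤Σ (0≤f ∘ suc) i))

Σ-δ : ∀ {n} {f : Fin n → ℚ} c → (∀ i → i ≢ c → f i ≡ 0ℚ) → Σ[ f ] ≡ f c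
Σ-δ {f = f} zero    off = trans (cong (f zero +_) (Σ-zero (λ i → off (suc i) λ ()))) (+-identityʳ (f zero))
Σ-δ {f = f} (suc c) off = begin
  f zero + Σ[ f ∘ suc ]  ≡⟨ cong (_+ Σ[ f ∘ suc ]) (off zero λ ()) ⟩
  0ℚ + Σ[ f ∘ suc ]      ≡⟨ +-identityˡ Σ[ f ∘ suc ] ⟩
  Σ[ f ∘ suc ]           ≡⟨ Σ-δ c (λ i i≢c → off (suc i) (i≢c ∘ Fin.suc-injective)) ⟩
  f (suc c)              ∎
  where open ≡-Reasoning

ΣIf≡Σ : ∀ {n} {P : Fin n → Set} (P? : ∀ j → Dec (P j)) {f g : Fin n → ℚ} →
        (∀ j → P j → g j ≡ f j) → (∀ j → ¬ P j → g j ≡ 0ℚ) → ΣIf P? f ≡ Σ[ g ]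
ΣIf≡Σ {ℕ.zero}  P? on off = refl
ΣIf≡Σ {ℕ.suc n} P? on off with P? zero
... | yes p  = cong₂ _+_ (sym (on zero p))   (ΣIf≡Σ (P? ∘ suc) (on ∘ suc) (off ∘ suc))
... | no  ¬p = cong₂ _+_ (sym (off zero ¬p)) (ΣIf≡Σ (P? ∘ suc) (on ∘ suc) (off ∘ suc))

Σ𝟙∈≡∣∣ : ∀ {n} (C : Subset n) → Σ[ (λ i → 𝟙 (i ∈? C)) ] ≡ ℕtoℚ ∣ C ∣
Σ𝟙∈≡∣∣ Vec.[]            = refl
Σ𝟙∈≡∣∣ (inside Vec.∷ C)  = trans (cong (1ℚ +_) (Σ𝟙∈≡∣∣ C)) (sym (ℕtoℚ-suc ∣ C ∣))
Σ𝟙∈≡∣∣ (outside Vec.∷ C) = trans (+-identityˡ _) (Σ𝟙∈≡∣∣ C)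

-- Matrix products

⟨_,_⟩ : ∀ {n} → (Fin n → ℚ) → (Fin n → ℚ) → ℚ
⟨ a , v ⟩ = Σ[ (λ j → a j * v j) ]

colourMask : ∀ {n m} → (Fin n → Fin m) → Fin m → Fin n → ℚ
colourMask col h j = 𝟙 (col j ≟ᶠ h)

ΣColour≡⟨colourMask⟩ : ∀ {n m} (col : Fin n → Fin m) h (v : Fin n → ℚ) →
                       ΣColour col h v ≡ ⟨ colourMask col h , v ⟩
ΣColour≡⟨colourMask⟩ col h v = ΣIf≡Σ (λ j → col j ≟ᶠ h)
  (λ j → 𝟙*-yes (col j ≟ᶠ h)) (λ j ¬p → 𝟙*≡0 (col j ≟ᶠ h) (λ p → contradiction p ¬p))

infixl 7 _·_
_·_ : ∀ {r s t} → (Fin r → Fin s → ℚ) → (Fin s → Fin t → ℚ) → Fin r → Fin t → ℚ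
(W · x) i j = Σ[ (λ p → W i p * x p j) ]

⟨,⟩-· : ∀ {r s t} (W : Fin r → Fin s → ℚ) (x : Fin s → Fin t → ℚ) a i →
        ⟨ a , (W · x) i ⟩ ≡ Σ[ (λ p → W i p * ⟨ a , x p ⟩) ]
⟨,⟩-· W x a i = begin
  Σ[ (λ j → a j * Σ[ (λ p → W i p * x p j) ]) ]
    ≡⟨ Σ-cong (λ j → *-distribˡ-Σ (a j) (λ p → W i p * x p j)) ⟩
  Σ[ (λ j → Σ[ (λ p → a j * (W i p * x p j)) ]) ]
    ≡⟨ Σ-comm (λ j p → a j * (W i p * x p j)) ⟩
  Σ[ (λ p → Σ[ (λ j → a j * (W i p * x p j)) ]) ]
    ≡⟨ Σ-cong (λ p → Σ-cong (λ j → x∙yz≈y∙xz (a j) (W i p) (x p j))) ⟩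
  Σ[ (λ p → Σ[ (λ j → W i p * (a j * x p j)) ]) ]
    ≡⟨ Σ-cong (λ p → *-distribˡ-Σ (W i p) (λ j → a j * x p j)) ⟨
  Σ[ (λ p → W i p * ⟨ a , x p ⟩) ]
    ∎
  where open ≡-Reasoning

Σ-column-· : ∀ {r s t} (W : Fin r → Fin s → ℚ) (x : Fin s → Fin t → ℚ) →
             (∀ p → Σ[ (λ i → W i p) ] ≡ 1ℚ) → ∀ j → Σ[ (λ i → (W · x) i j) ] ≡ Σ[ (λ p → x p j) ]
Σ-column-· W x ΣW≡1 j = begin
  Σ[ (λ i → Σ[ (λ p → W i p * x p j) ]) ]  ≡⟨ Σ-comm (λ i p → W i p * x p j) ⟩
  Σ[ (λ p → Σ[ (λ i → W i p * x p j) ]) ]  ≡⟨ Σ-cong (λ p → *-distribʳ-Σ (x p j) (λ i → W i p)) ⟨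
  Σ[ (λ p → Σ[ (λ i → W i p) ] * x p j) ]  ≡⟨ Σ-cong (λ p → cong (_* x p j) (ΣW≡1 p)) ⟩
  Σ[ (λ p → 1ℚ * x p j) ]                  ≡⟨ Σ-cong (λ p → *-identityˡ (x p j)) ⟩
  Σ[ (λ p → x p j) ]                       ∎
  where open ≡-Reasoning

Σ-row-· : ∀ {r s t} (W : Fin r → Fin s → ℚ) (x : Fin s → Fin t → ℚ) i →
          Σ[ (W · x) i ] ≡ Σ[ (λ p → W i p * Σ[ x p ]) ]
Σ-row-· W x i = begin
  Σ[ (W · x) i ]                                ≡⟨ Σ≡⟨1,⟩ ((W · x) i) ⟩
  ⟨ (λ _ → 1ℚ) , (W · x) i ⟩                    ≡⟨ ⟨,⟩-· W x (λ _ → 1ℚ) i ⟩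
  Σ[ (λ p → W i p * ⟨ (λ _ → 1ℚ) , x p ⟩) ]    ≡⟨ Σ-cong (λ p → cong (W i p *_) (Σ≡⟨1,⟩ (x p))) ⟨
  Σ[ (λ p → W i p * Σ[ x p ]) ]                 ∎
  where
  open ≡-Reasoning
  Σ≡⟨1,⟩ : ∀ {t} (v : Fin t → ℚ) → Σ[ v ] ≡ ⟨ (λ _ → 1ℚ) , v ⟩
  Σ≡⟨1,⟩ v = Σ-cong (λ j → sym (*-identityˡ (v j)))

·-preserves-⟨,⟩-≤ : ∀ {r s t} {W : Fin r → Fin s → ℚ} {x : Fin s → Fin t → ℚ} (a b : Fin t → ℚ) →
                    (∀ i p → 0ℚ ≤ℚ W i p) → (∀ p → ⟨ a , x p ⟩ ≤ℚ ⟨ b , x p ⟩) →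
                    ∀ i → ⟨ a , (W · x) i ⟩ ≤ℚ ⟨ b , (W · x) i ⟩
·-preserves-⟨,⟩-≤ {W = W} {x} a b 0≤W a≤b i = begin
  ⟨ a , (W · x) i ⟩                   ≡⟨ ⟨,⟩-· W x a i ⟩
  Σ[ (λ p → W i p * ⟨ a , x p ⟩) ]   ≤⟨ Σ-mono-≤ (λ p → *-monoˡ-≤-nonNeg (W i p) {{nonNegative (0≤W i p)}}
                                                                          (a≤b p)) ⟩
  Σ[ (λ p → W i p * ⟨ b , x p ⟩) ]   ≡⟨ ⟨,⟩-· W x b i ⟨
  ⟨ b , (W · x) i ⟩                   ∎
  where open ≤-Reasoning

triangle-gap : ∀ {n} {d : Fin n → Fin n → ℚ} → IsMetric d →
               ∀ {r s i j p} → r + s < d i j → d p j ≤ℚ s → r < d p i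
triangle-gap {d = d} (_ , _ , _ , d-sym , d-tri) {r} {s} {i} {j} {p} r+s<dij dpj≤s =
  ≰⇒> (λ dpi≤r → <⇒≱ r+s<dij (begin
    d i j          ≤⟨ d-tri i p j ⟩
    d i p + d p j  ≡⟨ cong (_+ d p j) (d-sym i p) ⟩
    d p i + d p j  ≤⟨ +-mono-≤ dpi≤r dpj≤s ⟩
    r + s          ∎))
  where open ≤-Reasoning

θ-close : ∀ {n} {d : Fin n → Fin n → ℚ} {x : Fin n → Fin n → ℚ} {C : Subset n} {θ : Fin n → Fin n} {r} →
          IsMetric d → IsTheta d x C θ → (∀ p → ∃ λ c → c ∈ C × d p c ≤ℚ r) →
          ∀ p → ¬ InN x C p → d p (θ p) ≤ℚ r
θ-close {d = d} {C = C} {θ} {r} (d≥0 , _ , d-refl , _) isθ cover p unserved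
  with cover p | isθ p unserved | p ∈? C
... | c , c∈C , dpc≤r | _ , θ-fixes , _ | yes p∈C = begin
  d p (θ p)  ≡⟨ cong (d p) (θ-fixes p∈C) ⟩
  d p p      ≡⟨ d-refl p ⟩
  0ℚ         ≤⟨ d≥0 p c ⟩
  d p c      ≤⟨ dpc≤r ⟩
  r          ∎
  where open ≤-Reasoning
... | c , c∈C , dpc≤r | _ , _ , nearest | no p∉C = ≤-trans (nearest p∉C c c∈C) dpc≤r

rerouteY≡𝟙 : ∀ {n} (C : Subset n) i → rerouteY C i ≡ 𝟙 (i ∈? C)
rerouteY≡𝟙 C i with i ∈? C
... | yes _ = refl
... | no  _ = refl

Σ-rerouteY : ∀ {n} (C : Subset n) → Σ[ rerouteY C ] ≡ ℕtoℚ ∣ C ∣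
Σ-rerouteY C = trans (Σ-cong (rerouteY≡𝟙 C)) (Σ𝟙∈≡∣∣ C)

rerouteY-bounded : ∀ {n} (C : Subset n) i → 0ℚ ≤ℚ rerouteY C i × rerouteY C i ≤ℚ 1ℚ
rerouteY-bounded C i with i ∈? C
... | yes _ = 0≤1 , ≤-refl
... | no  _ = ≤-refl , 0≤1

rerouteY-integral : ∀ {n} (C : Subset n) i → rerouteY C i ≡ 0ℚ ⊎ rerouteY C i ≡ 1ℚ
rerouteY-integral C i with i ∈? C
... | yes _ = inj₂ refl
... | no  _ = inj₁ refl

-- The rerouting

module Rerouting {n : ℕ} (x : Fin n → Fin n → ℚ) (C : Subset n) (θ : Fin n → Fin n)
  (x-nonNeg : ∀ p j → 0ℚ ≤ℚ x p j) (θ-orphan∈C : ∀ p → ¬ InN x C p → θ p ∈ C) where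

  x≡0 : ∀ {p j} → ¬ 0ℚ < x p j → x p j ≡ 0ℚ
  x≡0 {p} {j} ¬pos = ≤-antisym (≮⇒≥ ¬pos) (x-nonNeg p j)

  load : Fin n → ℚ
  load p = Σ[ (λ c → 𝟙 (c ∈? C) * x p c) ]

  orphanedTo? : ∀ i p → Dec (¬ InN x C p × θ p ≡ i)
  orphanedTo? i p = ¬? (inN? x C p) ×-dec (θ p ≟ᶠ i)

  share : Fin n → Fin n → ℚ
  share i p with i ∈? C
  ... | yes _ = x p i * inv (load p) + 𝟙 (orphanedTo? i p)
  ... | no  _ = 0ℚ

  denom≡load : ∀ p → denom x C p ≡ load p
  denom≡load p = ΣIf≡Σ (λ c → (c ∈? C) ×-dec (0ℚ <? x p c))
    (λ c (c∈C , _) → 𝟙*-yes (c ∈? C) c∈C)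
    (λ c ¬served → 𝟙*≡0 (c ∈? C) (λ c∈C → x≡0 (λ pos → ¬served (c∈C , pos))))

  share-∈ : ∀ {i} p → i ∈ C → share i p ≡ x p i * inv (load p) + 𝟙 (orphanedTo? i p)
  share-∈ {i} p i∈C with i ∈? C
  ... | yes _   = refl
  ... | no  i∉C = contradiction i∈C i∉C

  share≡ : ∀ i p → share i p ≡ 𝟙 (i ∈? C) * x p i * inv (load p) + 𝟙 (orphanedTo? i p)
  share≡ i p with i ∈? C
  ... | yes _   = cong (λ a → a * inv (load p) + 𝟙 (orphanedTo? i p)) (sym (*-identityˡ (x p i)))
  ... | no  i∉C = sym (trans (cong₂ _+_ proportional≡0 orphaned≡0) (+-identityˡ 0ℚ))
    where
    proportional≡0 : 0ℚ * x p i * inv (load p) ≡ 0ℚ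
    proportional≡0 = trans (cong (_* inv (load p)) (*-zeroˡ (x p i))) (*-zeroˡ (inv (load p)))
    orphaned≡0 : 𝟙 (orphanedTo? i p) ≡ 0ℚ
    orphaned≡0 = 𝟙-no (orphanedTo? i p)
      (λ (unserved , θp≡i) → i∉C (subst (_∈ C) θp≡i (θ-orphan∈C p unserved)))

  reroute≡share·x-∉ : ∀ {i} j → i ∉ C → rerouteX x C θ i j ≡ (share · x) i j
  reroute≡share·x-∉ {i} j i∉C with i ∈? C
  ... | yes i∈C = contradiction i∈C i∉C
  ... | no  _   = sym (Σ-zero (λ p → *-zeroˡ (x p j)))

  reroute≡share·x-∈ : ∀ {i} j {i∈C : i ∈ C} → (i ∈? C) ≡ yes i∈C →
                      rerouteX x C θ i j ≡ (share · x) i j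
  reroute≡share·x-∈ {i} j {i∈C} i∈?C≡yes = begin
    rerouteX x C θ i j
      ≡⟨ unfold i∈?C≡yes ⟩
    ΣIf (λ p → 0ℚ <? x p i) (λ p → x p i * inv (denom x C p) * x p j) + Σ[ orphaned ]
      ≡⟨ cong₂ _+_ proportional-part (Σ-cong orphaned≡) ⟩
    Σ[ (λ p → w p * x p j) ] + Σ[ (λ p → 𝟙 (orphanedTo? i p) * x p j) ]
      ≡⟨ Σ-distrib-+ (λ p → w p * x p j) (λ p → 𝟙 (orphanedTo? i p) * x p j) ⟨
    Σ[ (λ p → w p * x p j + 𝟙 (orphanedTo? i p) * x p j) ]
      ≡⟨ Σ-cong (λ p → trans (cong (_* x p j) (share-∈ p i∈C))
                             (*-distribʳ-+ (x p j) (w p) (𝟙 (orphanedTo? i p)))) ⟨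
    (share · x) i j
      ∎
    where
    open ≡-Reasoning
    w : Fin n → ℚ
    w p = x p i * inv (load p)
    -- rerouteX decides orphanhood with a helper local to its definition in Defs, so the summand
    -- of its orphan sum cannot be written here; orphaned is fixed by unification in unfold.
    orphaned : Fin n → ℚ
    orphaned = _
    unfold : (i ∈? C) ≡ yes i∈C → rerouteX x C θ i j
           ≡ ΣIf (λ p → 0ℚ <? x p i) (λ p → x p i * inv (denom x C p) * x p j) + Σ[ orphaned ]
    unfold i∈?C≡yes with i ∈? C | i∈?C≡yes
    ... | .(yes i∈C) | refl = refl
    orphaned≡ : ∀ p → orphaned p ≡ 𝟙 (orphanedTo? i p) * x p j
    orphaned≡ p with inN? x C p | θ p ≟ᶠ i
    ... | yes _ | _     = sym (*-zeroˡ (x p j))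
    ... | no  _ | yes _ = sym (*-identityˡ (x p j))
    ... | no  _ | no  _ = sym (*-zeroˡ (x p j))
    proportional-part : ΣIf (λ p → 0ℚ <? x p i) (λ p → x p i * inv (denom x C p) * x p j)
                      ≡ Σ[ (λ p → w p * x p j) ]
    proportional-part = ΣIf≡Σ (λ p → 0ℚ <? x p i)
      (λ p _ → cong (λ D → x p i * inv D * x p j) (sym (denom≡load p)))
      (λ p ¬pos → trans (cong (λ a → a * inv (load p) * x p j) (x≡0 ¬pos))
                        (trans (cong (_* x p j) (*-zeroˡ (inv (load p)))) (*-zeroˡ (x p j))))

  -- Splitting on i ∈? C itself would unfold rerouteX in the goal, out of reach of reroute≡share·x-∈.
  reroute≡share·x : ∀ i j → rerouteX x C θ i j ≡ (share · x) i j
  reroute≡share·x i j with toSum (i ∈? C)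
  ... | inj₁ i∈C = reroute≡share·x-∈ j (proj₂ (dec-yes (i ∈? C) i∈C))
  ... | inj₂ i∉C = reroute≡share·x-∉ j i∉C

  load-nonNeg : ∀ p → 0ℚ ≤ℚ load p
  load-nonNeg p = Σ-nonNeg (λ c → *-nonNeg (𝟙-nonNeg (c ∈? C)) (x-nonNeg p c))

  x≤load : ∀ {i} p → i ∈ C → x p i ≤ℚ load p
  x≤load {i} p i∈C = subst (_≤ℚ load p) (𝟙*-yes (i ∈? C) i∈C)
    (term≤Σ (λ c → *-nonNeg (𝟙-nonNeg (c ∈? C)) (x-nonNeg p c)) i)

  load≤Σ : ∀ p → load p ≤ℚ Σ[ x p ]
  load≤Σ p = Σ-mono-≤ (λ c → 𝟙*-≤ (c ∈? C) (x-nonNeg p c))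

  load*inv≡𝟙 : ∀ p → load p * inv (load p) ≡ 𝟙 (inN? x C p)
  load*inv≡𝟙 p with inN? x C p
  ... | yes (c , c∈C , pos) =
    q*inv[q]≡1 (load p) (λ load≡0 → <⇒≱ pos (subst (x p c ≤ℚ_) load≡0 (x≤load p c∈C)))
  ... | no unserved = trans (cong (_* inv (load p)) load≡0) (*-zeroˡ (inv (load p)))
    where
    load≡0 : load p ≡ 0ℚ
    load≡0 = Σ-zero (λ c → 𝟙*≡0 (c ∈? C) (λ c∈C → x≡0 (λ pos → unserved (c , c∈C , pos))))

  Σ-orphanedTo : ∀ p → Σ[ (λ i → 𝟙 (orphanedTo? i p)) ] ≡ 𝟙 (¬? (inN? x C p))
  Σ-orphanedTo p with toSum (inN? x C p)
  ... | inj₁ served = trans (Σ-zero (λ i → 𝟙-no (orphanedTo? i p) (λ (unserved , _) → unserved served)))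
                            (sym (𝟙-no (¬? (inN? x C p)) (λ unserved → unserved served)))
  ... | inj₂ unserved = begin
    Σ[ (λ i → 𝟙 (orphanedTo? i p)) ]  ≡⟨ Σ-δ (θ p) (λ i i≢θp → 𝟙-no (orphanedTo? i p) (i≢θp ∘ sym ∘ proj₂)) ⟩
    𝟙 (orphanedTo? (θ p) p)           ≡⟨ 𝟙-yes (orphanedTo? (θ p) p) (unserved , refl) ⟩
    1ℚ                                ≡⟨ 𝟙-yes (¬? (inN? x C p)) unserved ⟨
    𝟙 (¬? (inN? x C p))               ∎
    where open ≡-Reasoning

  Σ-share : ∀ p → Σ[ (λ i → share i p) ] ≡ 1ℚ
  Σ-share p = begin
    Σ[ (λ i → share i p) ]
      ≡⟨ Σ-cong (λ i → share≡ i p) ⟩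
    Σ[ (λ i → 𝟙 (i ∈? C) * x p i * inv (load p) + 𝟙 (orphanedTo? i p)) ]
      ≡⟨ Σ-distrib-+ (λ i → 𝟙 (i ∈? C) * x p i * inv (load p)) (λ i → 𝟙 (orphanedTo? i p)) ⟩
    Σ[ (λ i → 𝟙 (i ∈? C) * x p i * inv (load p)) ] + Σ[ (λ i → 𝟙 (orphanedTo? i p)) ]
      ≡⟨ cong (_+ Σ[ (λ i → 𝟙 (orphanedTo? i p)) ]) (*-distribʳ-Σ (inv (load p)) (λ i → 𝟙 (i ∈? C) * x p i)) ⟨
    load p * inv (load p) + Σ[ (λ i → 𝟙 (orphanedTo? i p)) ]
      ≡⟨ cong₂ _+_ (load*inv≡𝟙 p) (Σ-orphanedTo p) ⟩
    𝟙 (inN? x C p) + 𝟙 (¬? (inN? x C p))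
      ≡⟨ 𝟙+𝟙¬≡1 (inN? x C p) ⟩
    1ℚ
      ∎
    where open ≡-Reasoning

  share-nonNeg : ∀ i p → 0ℚ ≤ℚ share i p
  share-nonNeg i p = subst (0ℚ ≤ℚ_) (sym (share≡ i p))
    (+-nonNeg (*-nonNeg (*-nonNeg (𝟙-nonNeg (i ∈? C)) (x-nonNeg p i)) (inv-nonNeg (load-nonNeg p)))
              (𝟙-nonNeg (orphanedTo? i p)))

  x≤share*Σ : ∀ {i} p → i ∈ C → x p i ≤ℚ share i p * Σ[ x p ]
  x≤share*Σ {i} p i∈C = begin
    x p i                                  ≡⟨ a*inv[q]*q≡a (x-nonNeg p i) (x≤load p i∈C) ⟨
    w * load p                             ≤⟨ *-monoˡ-≤-nonNeg w {{nonNegative 0≤w}} (load≤Σ p) ⟩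
    w * Σ[ x p ]                           ≤⟨ *-monoʳ-≤-nonNeg Σ[ x p ] {{nonNegative 0≤Σ}} w≤share ⟩
    (w + 𝟙 (orphanedTo? i p)) * Σ[ x p ]  ≡⟨ cong (_* Σ[ x p ]) (share-∈ p i∈C) ⟨
    share i p * Σ[ x p ]                   ∎
    where
    open ≤-Reasoning
    w : ℚ
    w = x p i * inv (load p)
    0≤w : 0ℚ ≤ℚ w
    0≤w = *-nonNeg (x-nonNeg p i) (inv-nonNeg (load-nonNeg p))
    0≤Σ : 0ℚ ≤ℚ Σ[ x p ]
    0≤Σ = Σ-nonNeg (x-nonNeg p)
    w≤share : w ≤ℚ w + 𝟙 (orphanedTo? i p)
    w≤share = p≤p+q (𝟙-nonNeg (orphanedTo? i p))

  share-vanishes : ∀ {d : Fin n → Fin n → ℚ} {μ r} →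
                   (∀ i j → μ < d i j → x i j ≡ 0ℚ) → μ ≤ℚ r → (∀ p → ¬ InN x C p → d p (θ p) ≤ℚ r) →
                   ∀ i p → r < d p i → share i p ≡ 0ℚ
  share-vanishes {d} {r = r} x-local μ≤r θ-near i p r<dpi with i ∈? C
  ... | no  _ = refl
  ... | yes _ = trans (cong₂ (λ a b → a * inv (load p) + b) xpi≡0 orphaned≡0)
                      (cong (_+ 0ℚ) (*-zeroˡ (inv (load p))))
    where
    xpi≡0 : x p i ≡ 0ℚ
    xpi≡0 = x-local p i (≤-<-trans μ≤r r<dpi)
    orphaned≡0 : 𝟙 (orphanedTo? i p) ≡ 0ℚ
    orphaned≡0 = 𝟙-no (orphanedTo? i p)
      (λ (unserved , θp≡i) → <⇒≱ r<dpi (subst (λ c → d p c ≤ℚ r) θp≡i (θ-near p unserved)))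

  reroute-nonNeg : ∀ i j → 0ℚ ≤ℚ rerouteX x C θ i j
  reroute-nonNeg i j = subst (0ℚ ≤ℚ_) (sym (reroute≡share·x i j))
    (Σ-nonNeg (λ p → *-nonNeg (share-nonNeg i p) (x-nonNeg p j)))

  Σ-reroute-column : ∀ j → Σ[ (λ i → rerouteX x C θ i j) ] ≡ Σ[ (λ p → x p j) ]
  Σ-reroute-column j = trans (Σ-cong (λ i → reroute≡share·x i j)) (Σ-column-· share x Σ-share j)

  reroute-≤1 : (∀ j → Σ[ (λ i → x i j) ] ≡ 1ℚ) → ∀ i j → rerouteX x C θ i j ≤ℚ 1ℚ
  reroute-≤1 Σx≡1 i j = subst (rerouteX x C θ i j ≤ℚ_) (trans (Σ-reroute-column j) (Σx≡1 j))
    (term≤Σ (λ i′ → reroute-nonNeg i′ j) i)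

  reroute-≤-y : (∀ j → Σ[ (λ i → x i j) ] ≡ 1ℚ) → ∀ i j → rerouteX x C θ i j ≤ℚ rerouteY C i
  reroute-≤-y Σx≡1 i j with i ∈? C | reroute-≤1 Σx≡1 i j
  ... | yes _ | x′≤1 = x′≤1
  ... | no  _ | _    = ≤-refl

  reroute-row≥1 : (∀ j → Σ[ (λ i → x i j) ] ≡ 1ℚ) → ∀ i → i ∈ C → 1ℚ ≤ℚ Σ[ rerouteX x C θ i ]
  reroute-row≥1 Σx≡1 i i∈C = begin
    1ℚ                                  ≡⟨ Σx≡1 i ⟨
    Σ[ (λ p → x p i) ]                  ≤⟨ Σ-mono-≤ (λ p → x≤share*Σ p i∈C) ⟩
    Σ[ (λ p → share i p * Σ[ x p ]) ]   ≡⟨ Σ-row-· share x i ⟨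
    Σ[ (share · x) i ]                  ≡⟨ Σ-cong (reroute≡share·x i) ⟨
    Σ[ rerouteX x C θ i ]               ∎
    where open ≤-Reasoning

  reroute-preserves-≤ : ∀ {F G : (Fin n → ℚ) → ℚ} (a b : Fin n → ℚ) →
                        (∀ v → F v ≡ ⟨ a , v ⟩) → (∀ v → G v ≡ ⟨ b , v ⟩) →
                        (∀ p → F (x p) ≤ℚ G (x p)) → ∀ i → F (rerouteX x C θ i) ≤ℚ G (rerouteX x C θ i)
  reroute-preserves-≤ {F} {G} a b F≡ G≡ F≤G i = begin
    F (rerouteX x C θ i)   ≡⟨ trans (F≡ _) (⟨,⟩-reroute a) ⟩
    ⟨ a , (share · x) i ⟩  ≤⟨ ·-preserves-⟨,⟩-≤ a b share-nonNeg ⟨a,x⟩≤⟨b,x⟩ i ⟩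
    ⟨ b , (share · x) i ⟩  ≡⟨ trans (G≡ _) (⟨,⟩-reroute b) ⟨
    G (rerouteX x C θ i)   ∎
    where
    open ≤-Reasoning
    ⟨a,x⟩≤⟨b,x⟩ : ∀ p → ⟨ a , x p ⟩ ≤ℚ ⟨ b , x p ⟩
    ⟨a,x⟩≤⟨b,x⟩ p = subst₂ _≤ℚ_ (F≡ (x p)) (G≡ (x p)) (F≤G p)
    ⟨,⟩-reroute : ∀ c → ⟨ c , rerouteX x C θ i ⟩ ≡ ⟨ c , (share · x) i ⟩
    ⟨,⟩-reroute c = Σ-cong (λ j → cong (c j *_) (reroute≡share·x i j))

  reroute-far : ∀ {d : Fin n → Fin n → ℚ} {μ r} → IsMetric d →
                (∀ i j → μ < d i j → x i j ≡ 0ℚ) → μ ≤ℚ r → (∀ p → ¬ InN x C p → d p (θ p) ≤ℚ r) →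
                ∀ i j → r + μ < d i j → rerouteX x C θ i j ≡ 0ℚ
  reroute-far {d} {μ} metric x-local μ≤r θ-near i j r+μ<dij = trans (reroute≡share·x i j) (Σ-zero term)
    where
    term : ∀ p → share i p * x p j ≡ 0ℚ
    term p with μ <? d p j
    ... | yes μ<dpj = trans (cong (share i p *_) (x-local p j μ<dpj)) (*-zeroʳ (share i p))
    ... | no  μ≮dpj = trans (cong (_* x p j) share≡0) (*-zeroˡ (x p j))
      where
      share≡0 : share i p ≡ 0ℚ
      share≡0 = share-vanishes x-local μ≤r θ-near i p (triangle-gap metric r+μ<dij (≮⇒≥ μ≮dpj))

lemma10 : (n m k : ℕ) (d : Fin n → Fin n → ℚ) → IsMetric d →
    1 ≤ k → k ≤ n →
    (col : Fin n → Fin m) → Surjective _≡_ _≡_ col →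
    (ℓ u : Fin m → ℚ) → (∀ h → 0ℚ ≤ℚ ℓ h × ℓ h ≤ℚ u h × u h ≤ℚ 1ℚ) →
    (α λ' : ℚ) → 1ℚ ≤ℚ α → 0ℚ ≤ℚ λ' →
    (C : Subset n) → ∣ C ∣ ≤ k →
    (∀ p → ∃ λ i → i ∈ C × d p i ≤ℚ α * λ') →
    (x : Fin n → Fin n → ℚ) (y : Fin n → ℚ) →
    LPFeasible d k col ℓ u λ' x y →
    (θ : Fin n → Fin n) → IsTheta d x C θ →
      LPFeasible d k col ℓ u ((α + 1ℚ) * λ') (rerouteX x C θ) (rerouteY C)
    × (∀ i → i ∈ C → 1ℚ ≤ℚ Σ[ rerouteX x C θ i ])
    × (∀ i → rerouteY C i ≡ 0ℚ ⊎ rerouteY C i ≡ 1ℚ)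
lemma10 n m k d metric _ _ col _ ℓ u _ α λ' 1≤α 0≤λ C ∣C∣≤k cover x y
        (Σx≡1 , _ , _ , ℓ-fair , u-fair , x-local , x-bounded , _) θ isθ =
  ( ( (λ j → trans (Σ-reroute-column j) (Σx≡1 j))
    , reroute-≤-y Σx≡1
    , ≤-trans (≤-reflexive (Σ-rerouteY C)) (ℕtoℚ-mono-≤ ∣C∣≤k)
    , (λ h → reroute-preserves-≤ (λ _ → ℓ h) (colourMask col h)
                                  (*-distribˡ-Σ (ℓ h)) (ΣColour≡⟨colourMask⟩ col h) (ℓ-fair h))
    , (λ h → reroute-preserves-≤ (colourMask col h) (λ _ → u h)
                                  (ΣColour≡⟨colourMask⟩ col h) (*-distribˡ-Σ (u h)) (u-fair h))
    , (λ i j → reroute-far metric x-local λ≤αλ (θ-close metric isθ cover) i j ∘ subst (_< d i j) [α+1]λ≡αλ+λ)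
    , (λ i j → reroute-nonNeg i j , reroute-≤1 Σx≡1 i j)
    , rerouteY-bounded C )
  , reroute-row≥1 Σx≡1
  , rerouteY-integral C )
  where
  open Rerouting x C θ (λ p j → proj₁ (x-bounded p j)) (λ p unserved → proj₁ (isθ p unserved))
  λ≤αλ : λ' ≤ℚ α * λ'
  λ≤αλ = subst (_≤ℚ α * λ') (*-identityˡ λ') (*-monoʳ-≤-nonNeg λ' {{nonNegative 0≤λ}} 1≤α)
  [α+1]λ≡αλ+λ : (α + 1ℚ) * λ' ≡ α * λ' + λ'
  [α+1]λ≡αλ+λ = trans (*-distribʳ-+ λ' α 1ℚ) (cong (α * λ' +_) (*-identityˡ λ'))
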